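{- Let $R$ be a ring and $G$ a group, and let $RG$ denote the group ring. Let $\{N_1,\dots,N_k\}$ be a collection of ideals of $R$ satisfying the CNC-condition, and let $s_i$ be the characteristic of $N_i$ in $N_{i+1}$ ($i=1,\dots,k-1$). Then: (1) If $w$ is a natural number with $\bar x^{\,w}=\bar 1$ for all $\bar x\in ((R/N_1)G)^*$, then $x^{w s_1\cdots s_{k-1}}=1$ for all $x\in (RG)^*$. (2) If $((R/N_1)G)^*$ is finite, then $x^{|((R/N_1)G)^*|\, s_1\cdots s_{k-1}}=1$ for all $x\in (RG)^*$. (3) If $(RG)^*$ is finite, then $x^{|((R/N_1)G)^*|\,|N_1|^{|G|}}=1$ for all $x\in (RG)^*$.
   Context: Rings are associative with identity, not necessarily commutative; $S^*$ denotes the group of units of a ring $S$. A collection $\{N_1,\dots,N_k\}$ of ideals of $R$ satisfies the CNC-condition if: (i) $\{0\}=N_k\subset N_{k-1}\subset\cdots\subset N_1\subset R$; (ii) for each $i=1,\dots,k-1$ there is $t_i\ge 2$ with $N_i^{t_i}\subset N_{i+1}$ (the minimal such $t_i$ is the nilpotency index of $N_i$ in $N_{i+1}$); (iii) for each $i=1,\dots,k-1$ there is $s_i\ge 1$ with $s_iN_i\subset N_{i+1}$ and all prime factors of $s_i$ are $\ge t_i$; the minimal such $s_i$ is called the characteristic of $N_i$ in $N_{i+1}$. -}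

module Defs where

open import Level using (Level; _⊔_; suc)
open import Algebra.Bundles using (Ring; Group)
open import Algebra.Core using (Op₁; Op₂)
open import Data.Nat as ℕ using (ℕ; zero; _≤_)
open import Data.Nat.Divisibility using (_∣_)
open import Data.Nat.Primality using (Prime)
open import Data.Fin using (Fin; inject₁; fromℕ)
import Data.Fin as F
open import Data.List using (List; []; _∷_; _++_; map; concatMap; foldr)
open import Data.Vec using (Vec)
open import Data.Vec.Relation.Unary.All using (All)
open import Data.Product using (Σ; _×_; _,_; ∃; ∃-syntax)
open import Relation.Unary using (Pred; _⊆_)
open import Relation.Binary.Core using (Rel)
open import Relation.Binary.PropositionalEquality using (_≡_)

HasCard : ∀ {a ℓ} (A : Set a) (_≈_ : Rel A ℓ) → ℕ → Set (a ⊔ ℓ)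
HasCard A _≈_ n =
  Σ (Fin n → A) λ f →
    (∀ i j → f i ≈ f j → i ≡ j) × (∀ x → ∃[ i ] (f i ≈ x))

prodFin : ∀ {m} → (Fin m → ℕ) → ℕ
prodFin {zero}    s = 1
prodFin {ℕ.suc m} s = s F.zero ℕ.* prodFin (λ i → s (F.suc i))

-- The group ring A G over a ring presented by a carrier, an equivalence
-- (used to also present quotient rings) and the ring operations.
-- Elements are formal finite sums  Σ r_j g_j  (lists of pairs), modulo
-- the congruence generated by the relations of the free A-module on G.

module GroupRing {a ℓa g ℓg} (A : Set a) (_≈_ : Rel A ℓa)
                 (_+_ _*_ : Op₂ A) (0# 1# : A) (G : Group g ℓg) where

  open Group G renaming (Carrier to Gc; _≈_ to _≈G_; _∙_ to _·_; ε to e)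

  Elt : Set (a ⊔ g)
  Elt = List (Gc × A)

  infix 4 _∼_
  data _∼_ : Elt → Elt → Set (a ⊔ ℓa ⊔ g ⊔ ℓg) where
    ∼-refl  : ∀ {x} → x ∼ x
    ∼-sym   : ∀ {x y} → x ∼ y → y ∼ x
    ∼-trans : ∀ {x y z} → x ∼ y → y ∼ z → x ∼ z
    ∼-++    : ∀ {x x′ y y′} → x ∼ x′ → y ∼ y′ → x ++ y ∼ x′ ++ y′
    ∼-swap  : ∀ {p q} → p ∷ q ∷ [] ∼ q ∷ p ∷ []
    ∼-cong  : ∀ {h h′ r r′} → h ≈G h′ → r ≈ r′ → (h , r) ∷ [] ∼ (h′ , r′) ∷ []
    ∼-merge : ∀ {h r r′} → (h , r) ∷ (h , r′) ∷ [] ∼ (h , r + r′) ∷ []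
    ∼-zero  : ∀ {h} → (h , 0#) ∷ [] ∼ []

  one : Elt
  one = (e , 1#) ∷ []

  _⊗_ : Elt → Elt → Elt
  x ⊗ y = concatMap (λ { (g₁ , r) → map (λ { (h₁ , s) → (g₁ · h₁ , r * s) }) y }) x

  pow : Elt → ℕ → Elt
  pow x zero      = one
  pow x (ℕ.suc n) = x ⊗ pow x n

  IsUnit : Elt → Set (a ⊔ ℓa ⊔ g ⊔ ℓg)
  IsUnit x = ∃[ y ] (x ⊗ y ∼ one × y ⊗ x ∼ one)

  Units : Set (a ⊔ ℓa ⊔ g ⊔ ℓg)
  Units = Σ Elt IsUnit

  _≈U_ : Rel Units (a ⊔ ℓa ⊔ g ⊔ ℓg)
  (x , _) ≈U (y , _) = x ∼ y

module RingNotions {c ℓ} (R : Ring c ℓ) where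
  open Ring R

  _−_ : Op₂ Carrier
  x − y = x + (- y)

  _·ₙ_ : ℕ → Carrier → Carrier
  zero    ·ₙ x = 0#
  ℕ.suc n ·ₙ x = x + (n ·ₙ x)

  record IsIdeal {p} (N : Pred Carrier p) : Set (c ⊔ ℓ ⊔ p) where
    field
      resp  : ∀ {x y} → x ≈ y → N x → N y
      zero∈ : N 0#
      +∈    : ∀ {x y} → N x → N y → N (x + y)
      -∈    : ∀ {x} → N x → N (- x)
      *ˡ∈   : ∀ r {x} → N x → N (r * x)
      *ʳ∈   : ∀ r {x} → N x → N (x * r)

  vprod : ∀ {t} → Vec Carrier t → Carrier
  vprod Vec.[] = 1#
  vprod (x Vec.∷ v) = x * vprod v

  data IdealPow {p} (N : Pred Carrier p) (t : ℕ) : Pred Carrier (c ⊔ ℓ ⊔ p) where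
    prod : ∀ {x} (v : Vec Carrier t) → All N v → x ≈ vprod v → IdealPow N t x
    zer  : IdealPow N t 0#
    add  : ∀ {x y} → IdealPow N t x → IdealPow N t y → IdealPow N t (x + y)

  MultIn : ∀ {p} → Pred Carrier p → Pred Carrier p → ℕ → Set (c ⊔ p)
  MultIn N M s = ∀ x → N x → M (s ·ₙ x)

  -- CNC-condition for ideals N_1,...,N_k, with k = suc m and N_{i+1} = N (suc i)
  record CNC {p} (m : ℕ) (N : Fin (ℕ.suc m) → Pred Carrier p) : Set (c ⊔ ℓ ⊔ suc p) where
    field
      ideals : ∀ i → IsIdeal (N i)
      bottom⇒ : ∀ x → N (fromℕ m) x → x ≈ 0#
      bottom⇐ : ∀ x → x ≈ 0# → N (fromℕ m) x
      chain  : ∀ (i : Fin m) → N (F.suc i) ⊆ N (inject₁ i)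
      nilchar : ∀ (i : Fin m) → ∃[ t ] (2 ≤ t × (IdealPow (N (inject₁ i)) t ⊆ N (F.suc i))
                  × ∃[ s ] (1 ≤ s × MultIn (N (inject₁ i)) (N (F.suc i)) s
                            × (∀ q → Prime q → q ∣ s → t ≤ q)))

  IsCharacteristic : ∀ {p} → Pred Carrier p → Pred Carrier p → ℕ → Set (c ⊔ p)
  IsCharacteristic N M s =
    1 ≤ s × MultIn N M s × (∀ s′ → 1 ≤ s′ → MultIn N M s′ → s ≤ s′)

module RG {c ℓ g ℓg} (R : Ring c ℓ) (G : Group g ℓg) =
  GroupRing (Ring.Carrier R) (Ring._≈_ R) (Ring._+_ R) (Ring._*_ R) (Ring.0# R) (Ring.1# R) G

-- (R/N)G, with R/N presented as R with equivalence  x ~ y  iff  x - y ∈ N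
module QG {c ℓ g ℓg p} (R : Ring c ℓ) (N : Pred (Ring.Carrier R) p) (G : Group g ℓg) =
  GroupRing (Ring.Carrier R) (λ x y → N (RingNotions._−_ R x y))
            (Ring._+_ R) (Ring._*_ R) (Ring.0# R) (Ring.1# R) G

{-# OPTIONS --safe #-}
-- A unit x of RG maps to a unit of (R/N₁)G, so x^w ≡ 1 modulo N₁G, i.e. x^w = 1 + y with y ∈ N₁G.
-- If y ∈ N_i G then (1 + y)^{s_i} = 1 + y′ with y′ ∈ N_{i+1} G: in the binomial expansion the terms
-- C(s_i, j) y^j with j ≥ t_i lie in N_i^{t_i} G ⊆ N_{i+1} G, while for 1 ≤ j < t_i every prime factor
-- of s_i exceeds j, so s_i divides C(s_i, j), and s_i N_i ⊆ N_{i+1}. Descending the chain to N_k = 0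
-- gives x^{w s_1⋯s_{k-1}} = 1. Parts (2) and (3) obtain w from Lagrange's theorem, in ((R/N₁)G)^* and
-- in the group 1 + N₁G of order |N₁|^|G| respectively; Lagrange's theorem is proved by observing that
-- left multiplication by u permutes a finite set of cancellable elements with orbits of equal length.
module Submission where

open import Defs
open import Algebra.Bundles using (Ring; Group; Semiring; Monoid; CommutativeMonoid)
open import Algebra.Structures using (IsCommutativeMonoid)
import Algebra.Definitions.RawSemiring as RawSemiringDefs
import Algebra.Properties.AbelianGroup as AbelianGroupProperties
import Algebra.Properties.CommutativeSemigroup as CommSemigroupProperties
import Algebra.Properties.Group as GroupProperties
import Algebra.Properties.Ring as RingProperties
import Algebra.Properties.Semiring.Binomial as Binomial
import Algebra.Properties.Semiring.Exp as SemiringExp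
open import Data.Bool using (if_then_else_)
open import Data.Empty using (⊥-elim)
open import Data.Fin as Fin using (Fin; zero; toℕ; inject₁; fromℕ)
import Data.Fin.Properties as FinP
open import Data.List as List using (List; []; _∷_; _++_; map; length; filter; applyUpTo; allFin)
import Data.List.Properties as ListP
open import Data.List.Membership.Propositional using (_∈_; _∉_)
import Data.List.Membership.Propositional.Properties as MemP
open import Data.List.Membership.Propositional.Properties.WithK using (unique∧set⇒bag)
open import Data.List.Relation.Binary.BagAndSetEquality using (∼bag⇒↭)
import Data.List.Relation.Binary.Permutation.Propositional as Perm
import Data.List.Relation.Binary.Permutation.Propositional.Properties as PermP
open import Data.List.Relation.Unary.All as All using (All; []; _∷_)
import Data.List.Relation.Unary.All.Properties as AllP
open import Data.List.Relation.Unary.Any using (here)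
open import Data.List.Relation.Unary.Unique.Propositional using (Unique)
import Data.List.Relation.Unary.Unique.Propositional.Properties as UniqueP
open import Data.Nat as ℕ using (ℕ; zero; suc; _≤_; _<_; z≤n; s≤s; _∸_; _^_)
import Data.Nat.Properties as ℕP
open import Data.Nat.Combinatorics using (_C_; nCk+nC[k+1]≡[n+1]C[k+1]; k>n⇒nCk≡0; nC1≡n)
open import Data.Nat.Coprimality using (Coprime; coprime-divisor)
open import Data.Nat.Divisibility using (_∣_; divides; ∣-trans; ∣⇒≤; m∣m*n; ∣-refl; ∣m∣n⇒∣m+n)
open import Data.Nat.GCD using (gcd; gcd-GCD; gcd[m,n]∣m; gcd[m,n]∣n; gcd[m,n]≢0; module Bézout)
open import Data.Nat.GeneralisedArithmetic using (fold; fold-+)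
open import Data.Nat.ListAction using (product)
open import Data.Nat.Primality using (Prime)
open import Data.Nat.Primality.Factorisation using (factorise)
open import Data.Nat.Tactic.RingSolver using (solve-∀)
open import Data.Product using (Σ; _×_; _,_; proj₁; proj₂; ∃; ∃-syntax)
open import Data.Sum using (inj₁)
open import Data.Vec as Vec using (Vec)
import Data.Vec.Functional as VecF
import Data.Vec.Relation.Unary.All as VecAll
open import Function using (_∘_; id)
open import Function.Bundles using (mk⇔)
open import Relation.Binary.PropositionalEquality as ≡ using (_≡_; _≢_; refl)
open import Relation.Binary.Structures using (IsEquivalence)
open import Relation.Nullary using (Dec; does; yes; no; ¬_; ¬?; _×-dec_)
open import Relation.Unary using (Pred; _⊆_)

[1+k]*[1+n]C[1+k] : ∀ n k → suc k ℕ.* (suc n C suc k) ≡ suc n ℕ.* (n C k)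
[1+k]*[1+n]C[1+k] zero    zero    = refl
[1+k]*[1+n]C[1+k] zero    (suc k) rewrite k>n⇒nCk≡0 {1} {suc (suc k)} (s≤s (s≤s z≤n))
                                        | k>n⇒nCk≡0 {0} {suc k} (s≤s z≤n) = ℕP.*-zeroʳ (suc (suc k))
[1+k]*[1+n]C[1+k] (suc n) zero    = ≡.trans (ℕP.+-identityʳ _) (≡.trans (nC1≡n (suc (suc n)))
                                                                      (≡.sym (ℕP.*-identityʳ (suc (suc n)))))
[1+k]*[1+n]C[1+k] (suc n) (suc k) = begin
    suc (suc k) ℕ.* (suc (suc n) C suc (suc k))
      ≡⟨ ≡.cong (suc (suc k) ℕ.*_) (≡.sym (nCk+nC[k+1]≡[n+1]C[k+1] (suc n) (suc k))) ⟩
    suc (suc k) ℕ.* (A ℕ.+ B)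
      ≡⟨ distribute (suc k) A B ⟩
    A ℕ.+ (suc k ℕ.* A ℕ.+ suc (suc k) ℕ.* B)
      ≡⟨ ≡.cong₂ (λ u v → A ℕ.+ (u ℕ.+ v)) ([1+k]*[1+n]C[1+k] n k) ([1+k]*[1+n]C[1+k] n (suc k)) ⟩
    A ℕ.+ (suc n ℕ.* (n C k) ℕ.+ suc n ℕ.* (n C suc k))
      ≡⟨ ≡.cong (A ℕ.+_) (≡.sym (ℕP.*-distribˡ-+ (suc n) (n C k) (n C suc k))) ⟩
    A ℕ.+ suc n ℕ.* ((n C k) ℕ.+ (n C suc k))
      ≡⟨ ≡.cong (λ u → A ℕ.+ suc n ℕ.* u) (nCk+nC[k+1]≡[n+1]C[k+1] n k) ⟩
    A ℕ.+ suc n ℕ.* A ∎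
  where
    open ≡.≡-Reasoning
    A = suc n C suc k
    B = suc n C suc (suc k)
    distribute : ∀ k a b → suc k ℕ.* (a ℕ.+ b) ≡ a ℕ.+ (k ℕ.* a ℕ.+ suc k ℕ.* b)
    distribute = solve-∀

∃-prime-∣ : ∀ d → 2 ≤ d → ∃[ p ] (Prime p × p ∣ d)
∃-prime-∣ d@(suc _) 2≤d with factorise d
... | record { factors = [] ; isFactorisation = eq } =
  ⊥-elim (ℕP.<-irrefl refl (ℕP.≤-trans 2≤d (ℕP.≤-reflexive eq)))
... | record { factors = p ∷ ps ; isFactorisation = eq ; factorsPrime = prime-p ∷ _ } =
  p , prime-p , divides (product ps) (≡.trans eq (ℕP.*-comm p (product ps)))

PrimeFactorsAtLeast : ℕ → ℕ → Set
PrimeFactorsAtLeast t s = ∀ q → Prime q → q ∣ s → t ≤ q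

primeFactorsAtLeast⇒coprime : ∀ {t s j} → PrimeFactorsAtLeast t s → 1 ≤ j → j < t → Coprime s j
primeFactorsAtLeast⇒coprime {j = j} _ 1≤j _ {zero} (_ , divides q j≡q*0) =
  ⊥-elim (ℕP.<-irrefl (≡.sym (≡.trans j≡q*0 (ℕP.*-zeroʳ q))) 1≤j)
primeFactorsAtLeast⇒coprime _ _ _ {suc zero} _ = refl
primeFactorsAtLeast⇒coprime {j = suc _} large 1≤j j<t {suc (suc _)} (d∣s , d∣j)
  with ∃-prime-∣ _ (s≤s (s≤s z≤n))
... | p , prime-p , p∣d = ⊥-elim (ℕP.<-irrefl refl
  (ℕP.≤-trans j<t (ℕP.≤-trans (large p prime-p (∣-trans p∣d d∣s)) (ℕP.≤-trans (∣⇒≤ p∣d) (∣⇒≤ d∣j)))))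

-- From j·(s C j) = s·((s−1) C (j−1)), since s is coprime to j.
∣-binomial : ∀ {t s j} → PrimeFactorsAtLeast t s → 1 ≤ j → j < t → s ∣ s C j
∣-binomial {s = zero} {j = suc k} _ _ _ rewrite k>n⇒nCk≡0 {0} {suc k} (s≤s z≤n) = divides 0 refl
∣-binomial {s = suc n} {j = suc k} large 1≤j j<t =
  coprime-divisor (primeFactorsAtLeast⇒coprime large 1≤j j<t)
    (≡.subst (suc n ∣_) (≡.sym ([1+k]*[1+n]C[1+k] n k)) (m∣m*n (n C k)))

prodFin-positive : ∀ {m} (s : Fin m → ℕ) → (∀ i → 1 ≤ s i) → 1 ≤ prodFin s
prodFin-positive {zero}  s _       = s≤s z≤n
prodFin-positive {suc m} s 1≤s = ℕP.*-mono-≤ (1≤s Fin.zero) (prodFin-positive (s ∘ Fin.suc) (1≤s ∘ Fin.suc))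

least-witness : ∀ {q} {P : ℕ → Set q} → (∀ k → Dec (P k)) → ∀ d → P d →
                ∃[ m ] (P m × ∀ k → k < m → ¬ P k)
least-witness P? zero    p = 0 , p , λ _ ()
least-witness P? (suc d) p with P? 0
... | yes p₀ = 0 , p₀ , λ _ ()
... | no ¬p₀ with least-witness (P? ∘ suc) d p
...   | m , pm , below = suc m , pm , λ { zero _ → ¬p₀ ; (suc k) (s≤s k<m) → below k k<m }

length-filter-split : ∀ {a q} {A : Set a} {P : A → Set q} (P? : ∀ x → Dec (P x)) xs →
                      length (filter P? xs) ℕ.+ length (filter (¬? ∘ P?) xs) ≡ length xs
length-filter-split P? []       = refl
length-filter-split P? (x ∷ xs) with P? x
... | yes _ = ≡.cong suc (length-filter-split P? xs)
... | no  _ = ≡.trans (ℕP.+-suc _ _) (≡.cong suc (length-filter-split P? xs))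

fold-multiple : ∀ {a} {A : Set a} (f : A → A) {D x} → fold x f D ≡ x → ∀ q → fold x f (q ℕ.* D) ≡ x
fold-multiple f         fᴰx≡x zero    = refl
fold-multiple f {D} {x} fᴰx≡x (suc q) =
  ≡.trans (fold-+ x f D) (≡.trans (≡.cong (λ y → fold y f D) (fold-multiple f fᴰx≡x q)) fᴰx≡x)

-- All orbits of f have the same length D, so they tile Fin n and D divides n.
module UniformPermutation {n} (f : Fin n → Fin n) (f-injective : ∀ {a b} → f a ≡ f b → a ≡ b)
  (uniform : ∀ j {a b} → fold a f j ≡ a → fold b f j ≡ b) where

  fold-injective : ∀ j {a b} → fold a f j ≡ fold b f j → a ≡ b
  fold-injective zero    eq = eq
  fold-injective (suc j) eq = fold-injective j (f-injective eq)

  fold-return : ∀ a → ∃[ d ] (1 ≤ d × fold a f d ≡ a)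
  fold-return a with FinP.pigeonhole (ℕP.n<1+n n) (λ k → fold a f (toℕ k))
  ... | i , j , i<j , fⁱa≡fʲa = toℕ j ∸ toℕ i , ℕP.m<n⇒0<n∸m i<j , fold-injective (toℕ i) (begin
    fold (fold a f (toℕ j ∸ toℕ i)) f (toℕ i)  ≡⟨ fold-+ a f (toℕ i) ⟨
    fold a f (toℕ i ℕ.+ (toℕ j ∸ toℕ i))      ≡⟨ ≡.cong (fold a f) (ℕP.m+[n∸m]≡n (ℕP.<⇒≤ i<j)) ⟩
    fold a f (toℕ j)                           ≡⟨ fⁱa≡fʲa ⟨
    fold a f (toℕ i)                           ∎)
    where open ≡.≡-Reasoning

  module Period (D : ℕ) (1≤D : 1 ≤ D) (fᴰ≡id : ∀ a → fold a f D ≡ a)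
                (aperiodic : ∀ k {a} → 1 ≤ k → k < D → fold a f k ≢ a) where

    orbit : Fin n → List (Fin n)
    orbit a = applyUpTo (fold a f) D

    orbit-unique : ∀ a → Unique (orbit a)
    orbit-unique a = UniqueP.applyUpTo⁺₁ (fold a f) D λ {i} {j} i<j j<D fⁱa≡fʲa →
      aperiodic (j ∸ i) (ℕP.m<n⇒0<n∸m i<j) (ℕP.≤-<-trans (ℕP.m∸n≤m j i) j<D)
        (≡.sym (fold-injective i (begin
          fold a f i                            ≡⟨ fⁱa≡fʲa ⟩
          fold a f j                            ≡⟨ ≡.cong (fold a f) (ℕP.m+[n∸m]≡n (ℕP.<⇒≤ i<j)) ⟨
          fold a f (i ℕ.+ (j ∸ i))              ≡⟨ fold-+ a f i ⟩
          fold (fold a f (j ∸ i)) f i           ∎)))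
      where open ≡.≡-Reasoning

    Closed : List (Fin n) → Set
    Closed M = ∀ {x} → x ∈ M → f x ∈ M

    orbit-⊆ : ∀ {M a} → Closed M → a ∈ M → ∀ {x} → x ∈ orbit a → x ∈ M
    orbit-⊆ {M} {a} closed a∈M x∈orbit with k , _ , ≡.refl ← MemP.∈-applyUpTo⁻ (fold a f) x∈orbit =
      iterate-∈ k
      where
        iterate-∈ : ∀ k → fold a f k ∈ M
        iterate-∈ zero    = a∈M
        iterate-∈ (suc k) = closed (iterate-∈ k)

    orbit-f⁻¹ : ∀ {a x} → f x ∈ orbit a → x ∈ orbit a
    orbit-f⁻¹ {a} fx∈orbit with MemP.∈-applyUpTo⁻ (fold a f) fx∈orbit
    ... | suc k , k<D , fx≡fᵏ⁺¹a = ≡.subst (_∈ orbit a) (≡.sym (f-injective fx≡fᵏ⁺¹a))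
                                           (MemP.∈-applyUpTo⁺ (fold a f) (ℕP.<-trans (ℕP.n<1+n k) k<D))
    ... | zero  , _   , fx≡a =
      ≡.subst (_∈ orbit a) (≡.sym (f-injective (≡.trans fx≡a (≡.sym fᴰa≡a))))
              (MemP.∈-applyUpTo⁺ (fold a f) (≡.subst (D ∸ 1 <_) 1+[D∸1]≡D (ℕP.n<1+n _)))
      where
        1+[D∸1]≡D : suc (D ∸ 1) ≡ D
        1+[D∸1]≡D = ℕP.m+[n∸m]≡n 1≤D
        fᴰa≡a : f (fold a f (D ∸ 1)) ≡ a
        fᴰa≡a = ≡.subst (λ d → fold a f d ≡ a) (≡.sym 1+[D∸1]≡D) (fᴰ≡id a)

    -- M splits into the orbit of its head, of length D, and a smaller closed remainder.
    D∣length : ∀ k M → length M ≤ k → Unique M → Closed M → D ∣ length M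
    D∣length _       []        _     _       _      = divides 0 refl
    D∣length (suc k) M@(a ∷ _) |M|≤k+1 unique closed =
      ≡.subst (D ∣_) split
        (∣m∣n⇒∣m+n (∣-refl {D}) (D∣length k rest |rest|≤k (UniqueP.filter⁺ outside? unique) rest-closed))
      where
        open import Data.List.Membership.DecPropositional FinP._≟_ using (_∈?_)
        inside? : ∀ x → Dec (x ∈ orbit a)
        inside? x = x ∈? orbit a
        outside? : ∀ x → Dec (x ∉ orbit a)
        outside? = ¬? ∘ inside?
        rest = filter outside? M
        inside = filter inside? M
        inside↭orbit : inside Perm.↭ orbit a
        inside↭orbit = ∼bag⇒↭ (unique∧set⇒bag (UniqueP.filter⁺ inside? unique) (orbit-unique a)
          (mk⇔ (λ x∈ → proj₂ (MemP.∈-filter⁻ inside? x∈))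
               (λ x∈ → MemP.∈-filter⁺ inside? (orbit-⊆ closed (here refl) x∈) x∈)))
        split : D ℕ.+ length rest ≡ length M
        split = ≡.trans (≡.cong (ℕ._+ length rest) (≡.trans (≡.sym (ListP.length-applyUpTo (fold a f) D))
                                                             (≡.sym (PermP.↭-length inside↭orbit))))
                        (length-filter-split inside? M)
        |rest|≤k : length rest ≤ k
        |rest|≤k = ℕP.≤-pred (ℕP.≤-trans (ℕP.+-monoˡ-≤ (length rest) 1≤D)
                                         (ℕP.≤-trans (ℕP.≤-reflexive split) |M|≤k+1))
        rest-closed : Closed rest
        rest-closed x∈rest with x∈M , x∉orbit ← MemP.∈-filter⁻ outside? x∈rest =
          MemP.∈-filter⁺ outside? (closed x∈M) (x∉orbit ∘ orbit-f⁻¹)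

  |allFin|≡n : length (allFin n) ≡ n
  |allFin|≡n = ListP.length-tabulate id

  returns? : ∀ a k → Dec (1 ≤ k × fold a f k ≡ a)
  returns? a k = (1 ℕP.≤? k) ×-dec (fold a f k FinP.≟ a)

  fold-size : ∀ a → fold a f n ≡ a
  fold-size a with fold-return a
  ... | d , returns-d with least-witness (returns? a) d returns-d
  ... | D , (1≤D , fᴰa≡a) , below
    with Period.D∣length D 1≤D (λ _ → uniform D fᴰa≡a)
           (λ k 1≤k k<D fᵏb≡b → below k k<D (1≤k , uniform k fᵏb≡b))
           n (allFin n) (ℕP.≤-reflexive |allFin|≡n) (UniqueP.allFin⁺ n) (λ _ → MemP.∈-allFin _)
  ... | divides q |allFin|≡q*D =
    ≡.subst (λ k → fold a f k ≡ a) (≡.trans (≡.sym |allFin|≡q*D) |allFin|≡n) (fold-multiple f fᴰa≡a q)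

module MonoidOrbits {a ℓ} (M : Monoid a ℓ) where
  open Monoid M renaming (refl to ≈-refl)
  open import Algebra.Definitions.RawMonoid rawMonoid using () renaming (_×_ to _times_)
  open import Relation.Binary.Reasoning.Setoid setoid

  infixr 8 _^ᴹ_
  _^ᴹ_ : Carrier → ℕ → Carrier
  u ^ᴹ n = n times u

  LeftCancellable : Carrier → Set _
  LeftCancellable u = ∀ {x y} → u ∙ x ≈ u ∙ y → x ≈ y

  RightCancellable : Carrier → Set _
  RightCancellable u = ∀ {x y} → x ∙ u ≈ y ∙ u → x ≈ y

  -- Left multiplication by u permutes the n points e i, with the same return times at every point.
  ^ᴹ-size≈ε : ∀ {n} (e : Fin n → Carrier) → (∀ i j → e i ≈ e j → i ≡ j) → (∀ i → RightCancellable (e i)) →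
              ∀ {u} → LeftCancellable u → (∀ i → ∃[ j ] (e j ≈ u ∙ e i)) → u ^ᴹ n ≈ ε
  ^ᴹ-size≈ε {zero}  _ _ _ _ _ = ≈-refl
  ^ᴹ-size≈ε {n@(suc _)} e e-injective e-cancel {u} u-cancel closed = uᵏ≈ε n Fin.zero (fold-size Fin.zero)
    where
      f : Fin n → Fin n
      f i = proj₁ (closed i)
      e-fold : ∀ k i → e (fold i f k) ≈ u ^ᴹ k ∙ e i
      e-fold zero    i = sym (identityˡ (e i))
      e-fold (suc k) i = begin
        e (f (fold i f k))      ≈⟨ proj₂ (closed (fold i f k)) ⟩
        u ∙ e (fold i f k)      ≈⟨ ∙-congˡ (e-fold k i) ⟩
        u ∙ (u ^ᴹ k ∙ e i)      ≈⟨ assoc u (u ^ᴹ k) (e i) ⟨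
        u ^ᴹ suc k ∙ e i        ∎
      f-injective : ∀ {i j} → f i ≡ f j → i ≡ j
      f-injective {i} {j} fi≡fj = e-injective i j (u-cancel (begin
        u ∙ e i      ≈⟨ proj₂ (closed i) ⟨
        e (f i)      ≡⟨ ≡.cong e fi≡fj ⟩
        e (f j)      ≈⟨ proj₂ (closed j) ⟩
        u ∙ e j      ∎))
      uᵏ≈ε : ∀ k i → fold i f k ≡ i → u ^ᴹ k ≈ ε
      uᵏ≈ε k i fᵏi≡i = e-cancel i (begin
        u ^ᴹ k ∙ e i     ≈⟨ e-fold k i ⟨
        e (fold i f k)   ≡⟨ ≡.cong e fᵏi≡i ⟩
        e i              ≈⟨ identityˡ (e i) ⟨
        ε ∙ e i          ∎)
      uniform : ∀ k {i j} → fold i f k ≡ i → fold j f k ≡ j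
      uniform k {i} {j} fᵏi≡i = e-injective _ _ (begin
        e (fold j f k)   ≈⟨ e-fold k j ⟩
        u ^ᴹ k ∙ e j     ≈⟨ ∙-congʳ (uᵏ≈ε k i fᵏi≡i) ⟩
        ε ∙ e j          ≈⟨ identityˡ (e j) ⟩
        e j              ∎)
      open UniformPermutation f f-injective uniform using (fold-size)

module GroupRingSemiring {c ℓ g ℓg} (S : Ring c ℓ) (G : Group g ℓg) where
  open Ring S using (Carrier; _≈_; _+_; _*_; 0#; 1#; *-cong; *-assoc; *-identityˡ; *-identityʳ;
                     distribˡ; distribʳ; zeroˡ; zeroʳ) renaming (refl to ≈-refl; sym to ≈-sym)
  open Group G using () renaming (Carrier to Gc; _∙_ to _·_; ε to e; assoc to ·-assoc;
    identityˡ to ·-identityˡ; identityʳ to ·-identityʳ; ∙-cong to ·-cong; refl to ·-refl)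
  open GroupRing Carrier _≈_ _+_ _*_ 0# 1# G public

  ∼-isEquivalence : IsEquivalence _∼_
  ∼-isEquivalence = record { refl = ∼-refl ; sym = ∼-sym ; trans = ∼-trans }

  ≡⇒∼ : ∀ {x y} → x ≡ y → x ∼ y
  ≡⇒∼ refl = ∼-refl

  ↭⇒∼ : ∀ {x y} → x Perm.↭ y → x ∼ y
  ↭⇒∼ Perm.refl          = ∼-refl
  ↭⇒∼ (Perm.prep p q)    = ∼-++ {x = p ∷ []} ∼-refl (↭⇒∼ q)
  ↭⇒∼ (Perm.swap p q r)  = ∼-++ {x = p ∷ q ∷ []} ∼-swap (↭⇒∼ r)
  ↭⇒∼ (Perm.trans q r)   = ∼-trans (↭⇒∼ q) (↭⇒∼ r)

  ∼-++ˡ : ∀ z {x y} → x ∼ y → z ++ x ∼ z ++ y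
  ∼-++ˡ z = ∼-++ (∼-refl {z})

  ∼-++ʳ : ∀ z {x y} → x ∼ y → x ++ z ∼ y ++ z
  ∼-++ʳ z p = ∼-++ p (∼-refl {z})

  ++-comm : ∀ x y → x ++ y ∼ y ++ x
  ++-comm x y = ↭⇒∼ (PermP.++-comm x y)

  ++-isCommutativeMonoid : IsCommutativeMonoid _∼_ _++_ []
  ++-isCommutativeMonoid = record
    { isMonoid = record
      { isSemigroup = record
        { isMagma = record { isEquivalence = ∼-isEquivalence ; ∙-cong = ∼-++ }
        ; assoc   = λ x y z → ≡⇒∼ (ListP.++-assoc x y z) }
      ; identity = (λ _ → ∼-refl) , (λ x → ≡⇒∼ (ListP.++-identityʳ x)) }
    ; comm = ++-comm }

  ++-commutativeMonoid : CommutativeMonoid _ _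
  ++-commutativeMonoid = record { isCommutativeMonoid = ++-isCommutativeMonoid }

  open CommSemigroupProperties (CommutativeMonoid.commutativeSemigroup ++-commutativeMonoid)
    using (interchange; xy∙z≈xz∙y) public

  map-cong : ∀ {f h : Gc × Carrier → Gc × Carrier} → (∀ p → f p ∷ [] ∼ h p ∷ []) →
             ∀ y → map f y ∼ map h y
  map-cong eq []      = ∼-refl
  map-cong eq (p ∷ y) = ∼-++ (eq p) (map-cong eq y)

  map-∼[] : ∀ {f : Gc × Carrier → Gc × Carrier} → (∀ p → f p ∷ [] ∼ []) → ∀ y → map f y ∼ []
  map-∼[] eq []      = ∼-refl
  map-∼[] eq (p ∷ y) = ∼-++ {x′ = []} (eq p) (map-∼[] eq y)

  map-merge : ∀ {f h k : Gc × Carrier → Gc × Carrier} → (∀ p → f p ∷ h p ∷ [] ∼ k p ∷ []) →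
              ∀ y → map f y ++ map h y ∼ map k y
  map-merge eq []      = ∼-refl
  map-merge {f} {h} eq (p ∷ y) =
    ∼-trans (interchange (f p ∷ []) (map f y) (h p ∷ []) (map h y)) (∼-++ (eq p) (map-merge eq y))

  _⊙_ : Gc × Carrier → Gc × Carrier → Gc × Carrier
  (g₁ , r) ⊙ (h₁ , s) = (g₁ · h₁ , r * s)

  ⊗-distribʳ-≡ : ∀ x x′ y → (x ++ x′) ⊗ y ≡ x ⊗ y ++ x′ ⊗ y
  ⊗-distribʳ-≡ []      x′ y = refl
  ⊗-distribʳ-≡ (p ∷ x) x′ y = ≡.trans (≡.cong (map (p ⊙_) y ++_) (⊗-distribʳ-≡ x x′ y))
                                     (≡.sym (ListP.++-assoc (map (p ⊙_) y) (x ⊗ y) (x′ ⊗ y)))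

  ⊗-zeroʳ-≡ : ∀ x → x ⊗ [] ≡ []
  ⊗-zeroʳ-≡ []      = refl
  ⊗-zeroʳ-≡ (p ∷ x) = ⊗-zeroʳ-≡ x

  ⊗-congˡ : ∀ y {x x′} → x ∼ x′ → x ⊗ y ∼ x′ ⊗ y
  ⊗-congˡ y ∼-refl        = ∼-refl
  ⊗-congˡ y (∼-sym p)     = ∼-sym (⊗-congˡ y p)
  ⊗-congˡ y (∼-trans p q) = ∼-trans (⊗-congˡ y p) (⊗-congˡ y q)
  ⊗-congˡ y (∼-++ {x} {x′} {z} {z′} p q) =
    ∼-trans (≡⇒∼ (⊗-distribʳ-≡ x z y))
      (∼-trans (∼-++ (⊗-congˡ y p) (⊗-congˡ y q)) (≡⇒∼ (≡.sym (⊗-distribʳ-≡ x′ z′ y))))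
  ⊗-congˡ y (∼-swap {p} {q}) =
    ∼-trans (≡⇒∼ (⊗-distribʳ-≡ (p ∷ []) (q ∷ []) y))
      (∼-trans (++-comm ((p ∷ []) ⊗ y) ((q ∷ []) ⊗ y))
        (≡⇒∼ (≡.sym (⊗-distribʳ-≡ (q ∷ []) (p ∷ []) y))))
  ⊗-congˡ y (∼-cong hh rr) =
    ∼-++ (map-cong (λ _ → ∼-cong (·-cong hh ·-refl) (*-cong rr ≈-refl)) y) ∼-refl
  ⊗-congˡ y (∼-merge {h} {r} {r′}) =
    ∼-trans (≡⇒∼ (≡.cong (map ((h , r) ⊙_) y ++_) (ListP.++-identityʳ (map ((h , r′) ⊙_) y))))
      (∼-trans (map-merge (λ { (_ , s) → ∼-trans ∼-merge (∼-cong ·-refl (≈-sym (distribʳ s r r′))) }) y)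
               (≡⇒∼ (≡.sym (ListP.++-identityʳ _))))
  ⊗-congˡ y ∼-zero =
    ∼-++ {x′ = []} (map-∼[] (λ { (_ , s) → ∼-trans (∼-cong ·-refl (zeroˡ s)) ∼-zero }) y) ∼-refl

  map-⊙-cong : ∀ p {y y′} → y ∼ y′ → map (p ⊙_) y ∼ map (p ⊙_) y′
  map-⊙-cong p ∼-refl         = ∼-refl
  map-⊙-cong p (∼-sym q)      = ∼-sym (map-⊙-cong p q)
  map-⊙-cong p (∼-trans q q′) = ∼-trans (map-⊙-cong p q) (map-⊙-cong p q′)
  map-⊙-cong p (∼-++ {x} {x′} {z} {z′} q q′) =
    ∼-trans (≡⇒∼ (ListP.map-++ (p ⊙_) x z))
      (∼-trans (∼-++ (map-⊙-cong p q) (map-⊙-cong p q′)) (≡⇒∼ (≡.sym (ListP.map-++ (p ⊙_) x′ z′))))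
  map-⊙-cong p ∼-swap                       = ∼-swap
  map-⊙-cong p (∼-cong hh ss)               = ∼-cong (·-cong ·-refl hh) (*-cong ≈-refl ss)
  map-⊙-cong (_ , r) (∼-merge {_} {s} {s′}) = ∼-trans ∼-merge (∼-cong ·-refl (≈-sym (distribˡ r s s′)))
  map-⊙-cong (_ , r) ∼-zero                 = ∼-trans (∼-cong ·-refl (zeroʳ r)) ∼-zero

  ⊗-congʳ : ∀ x {y y′} → y ∼ y′ → x ⊗ y ∼ x ⊗ y′
  ⊗-congʳ []      q = ∼-refl
  ⊗-congʳ (p ∷ x) q = ∼-++ (map-⊙-cong p q) (⊗-congʳ x q)

  ⊗-cong : ∀ {x x′ y y′} → x ∼ x′ → y ∼ y′ → x ⊗ y ∼ x′ ⊗ y′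
  ⊗-cong {x′ = x′} {y = y} p q = ∼-trans (⊗-congˡ y p) (⊗-congʳ x′ q)

  map-⊙-⊗ : ∀ p y z → map (p ⊙_) y ⊗ z ∼ map (p ⊙_) (y ⊗ z)
  map-⊙-⊗ p              []             z = ∼-refl
  map-⊙-⊗ p@(g₁ , r) (q@(h₁ , s) ∷ y) z =
    ∼-trans (∼-++ (∼-trans (map-cong (λ { (k , u) → ∼-cong (·-assoc g₁ h₁ k) (*-assoc r s u) }) z)
                           (≡⇒∼ (ListP.map-∘ z)))
                  (map-⊙-⊗ p y z))
            (≡⇒∼ (≡.sym (ListP.map-++ (p ⊙_) (map (q ⊙_) z) (y ⊗ z))))

  ⊗-assoc : ∀ x y z → (x ⊗ y) ⊗ z ∼ x ⊗ (y ⊗ z)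
  ⊗-assoc []      y z = ∼-refl
  ⊗-assoc (p ∷ x) y z =
    ∼-trans (≡⇒∼ (⊗-distribʳ-≡ (map (p ⊙_) y) (x ⊗ y) z)) (∼-++ (map-⊙-⊗ p y z) (⊗-assoc x y z))

  ⊗-identityˡ : ∀ y → one ⊗ y ∼ y
  ⊗-identityˡ y = ∼-trans (≡⇒∼ (ListP.++-identityʳ _))
    (∼-trans (map-cong (λ { (k , s) → ∼-cong (·-identityˡ k) (*-identityˡ s) }) y) (≡⇒∼ (ListP.map-id y)))

  ⊗-identityʳ : ∀ x → x ⊗ one ∼ x
  ⊗-identityʳ []             = ∼-refl
  ⊗-identityʳ ((g₁ , r) ∷ x) = ∼-++ {x = (g₁ · e , r * 1#) ∷ []}
                                    (∼-cong (·-identityʳ g₁) (*-identityʳ r)) (⊗-identityʳ x)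

  ⊗-distribˡ : ∀ x y z → x ⊗ (y ++ z) ∼ x ⊗ y ++ x ⊗ z
  ⊗-distribˡ []      y z = ∼-refl
  ⊗-distribˡ (p ∷ x) y z =
    ∼-trans (∼-++ (≡⇒∼ (ListP.map-++ (p ⊙_) y z)) (⊗-distribˡ x y z))
            (interchange (map (p ⊙_) y) (map (p ⊙_) z) (x ⊗ y) (x ⊗ z))

  semiring : Semiring _ _
  semiring = record
    { isSemiring = record
      { isSemiringWithoutAnnihilatingZero = record
        { +-isCommutativeMonoid = ++-isCommutativeMonoid
        ; *-cong     = ⊗-cong
        ; *-assoc    = ⊗-assoc
        ; *-identity = ⊗-identityˡ , ⊗-identityʳ
        ; distrib    = ⊗-distribˡ , (λ z x y → ≡⇒∼ (⊗-distribʳ-≡ x y z)) }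
      ; zero = (λ _ → ∼-refl) , (λ x → ≡⇒∼ (⊗-zeroʳ-≡ x)) } }

module IdealTheory {c ℓ} (R : Ring c ℓ) where
  open Ring R renaming (refl to ≈-refl)
  open RingNotions R
  open import Relation.Binary.Reasoning.Setoid setoid
  private
    module +-AG = AbelianGroupProperties +-abelianGroup
    module +-G  = GroupProperties +-group
    module RP   = RingProperties R
    module +-CS = CommSemigroupProperties +-commutativeSemigroup

  −-trans : ∀ x y z → (x − y) + (y − z) ≈ x − z
  −-trans x y z = begin
    (x + - y) + (y + - z) ≈⟨ +-assoc x (- y) (y + - z) ⟩
    x + (- y + (y + - z)) ≈⟨ +-congˡ (+-assoc (- y) y (- z)) ⟨
    x + ((- y + y) + - z) ≈⟨ +-congˡ (+-congʳ (-‿inverseˡ y)) ⟩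
    x + (0# + - z)        ≈⟨ +-congˡ (+-identityˡ (- z)) ⟩
    x + - z               ∎

  −-+ : ∀ x u y v → (x + u) − (y + v) ≈ (x − y) + (u − v)
  −-+ x u y v = begin
    (x + u) + - (y + v)   ≈⟨ +-congˡ (+-AG.⁻¹-∙-comm y v) ⟨
    (x + u) + (- y + - v) ≈⟨ +-CS.interchange x u (- y) (- v) ⟩
    (x + - y) + (u + - v) ∎

  −-* : ∀ x u y v → (x * u) − (y * v) ≈ (x − y) * u + y * (u − v)
  −-* x u y v = sym (begin
    (x − y) * u + y * (u − v)                 ≈⟨ +-cong (RP.[y-z]x≈yx-zx u x y) (RP.x[y-z]≈xy-xz y u v) ⟩
    ((x * u) − (y * u)) + ((y * u) − (y * v)) ≈⟨ −-trans (x * u) (y * u) (y * v) ⟩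
    (x * u) − (y * v)                         ∎)

  +-−-cancel : ∀ a b → b + (a − b) ≈ a
  +-−-cancel a b = trans (+-comm b (a − b)) (+-G.//-rightDividesˡ b a)

  ·ₙ-homo-+ : ∀ m n x → (m ℕ.+ n) ·ₙ x ≈ m ·ₙ x + n ·ₙ x
  ·ₙ-homo-+ zero    n x = sym (+-identityˡ _)
  ·ₙ-homo-+ (suc m) n x = trans (+-congˡ (·ₙ-homo-+ m n x)) (sym (+-assoc x (m ·ₙ x) (n ·ₙ x)))

  ·ₙ-assoc : ∀ m n x → (m ℕ.* n) ·ₙ x ≈ m ·ₙ (n ·ₙ x)
  ·ₙ-assoc zero    n x = ≈-refl
  ·ₙ-assoc (suc m) n x = trans (·ₙ-homo-+ n (m ℕ.* n) x) (+-congˡ (·ₙ-assoc m n x))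

  ProductOf : ∀ {p} → Pred Carrier p → ℕ → Pred Carrier _
  ProductOf P j a = Σ (Vec Carrier j) λ v → VecAll.All P v × a ≡ vprod v

  module _ {p} {N : Pred Carrier p} (isIdeal : IsIdeal N) where
    open IsIdeal isIdeal

    regroup : ∀ t {j} → t ≤ j → (v : Vec Carrier (suc j)) → VecAll.All N v →
              Σ (Vec Carrier (suc t)) λ v′ → VecAll.All N v′ × vprod v ≈ vprod v′
    regroup zero    _         (a Vec.∷ w) (na VecAll.∷ _) =
      vprod (a Vec.∷ w) Vec.∷ Vec.[] , *ʳ∈ (vprod w) na VecAll.∷ VecAll.[] , sym (*-identityʳ _)
    regroup (suc t) (s≤s t≤j) (a Vec.∷ w) (na VecAll.∷ nw) with regroup t t≤j w nw
    ... | w′ , nw′ , eq = a Vec.∷ w′ , na VecAll.∷ nw′ , *-congˡ eq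

    productOf-∈ : ∀ {j x} → 1 ≤ j → ProductOf N j x → N x
    productOf-∈ (s≤s _) (a Vec.∷ v , na VecAll.∷ _ , ≡.refl) = *ʳ∈ (vprod v) na

    productOf-∈-idealPow : ∀ {t j x} → 1 ≤ t → t ≤ j → ProductOf N j x → IdealPow N t x
    productOf-∈-idealPow {suc t} _ (s≤s t≤j) (v , nv , ≡.refl) with regroup t t≤j v nv
    ... | v′ , nv′ , eq = IdealPow.prod v′ nv′ eq

    ·ₙ-∈ : ∀ n {x} → N x → N (n ·ₙ x)
    ·ₙ-∈ zero    _  = zero∈
    ·ₙ-∈ (suc n) nx = +∈ nx (·ₙ-∈ n nx)

    ≈⇒−∈ : ∀ {x y} → x ≈ y → N (x − y)
    ≈⇒−∈ eq = resp (sym (+-G.x≈y⇒x∙y⁻¹≈ε eq)) zero∈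

    quotientRing : Ring c p
    quotientRing = record
      { Carrier = Carrier ; _≈_ = λ x y → N (x − y) ; _+_ = _+_ ; _*_ = _*_ ; -_ = -_ ; 0# = 0# ; 1# = 1#
      ; isRing = record
        { +-isAbelianGroup = record
          { isGroup = record
            { isMonoid = record
              { isSemigroup = record
                { isMagma = record
                  { isEquivalence = record
                    { refl  = ≈⇒−∈ ≈-refl
                    ; sym   = λ {x} {y} n → resp (+-AG.⁻¹-anti-homo‿- x y) (-∈ n)
                    ; trans = λ {x} {y} {z} n n′ → resp (−-trans x y z) (+∈ n n′) }
                  ; ∙-cong = λ {x} {y} {u} {v} n n′ → resp (sym (−-+ x u y v)) (+∈ n n′) }
                ; assoc = λ x y z → ≈⇒−∈ (+-assoc x y z) }
              ; identity = (λ x → ≈⇒−∈ (+-identityˡ x)) , (λ x → ≈⇒−∈ (+-identityʳ x)) }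
            ; inverse = (λ x → ≈⇒−∈ (-‿inverseˡ x)) , (λ x → ≈⇒−∈ (-‿inverseʳ x))
            ; ⁻¹-cong = λ {x} {y} n → resp (sym (+-AG.⁻¹-∙-comm x (- y))) (-∈ n) }
          ; comm = λ x y → ≈⇒−∈ (+-comm x y) }
        ; *-cong = λ {x} {y} {u} {v} n n′ → resp (sym (−-* x u y v)) (+∈ (*ʳ∈ u n) (*ˡ∈ y n′))
        ; *-assoc = λ x y z → ≈⇒−∈ (*-assoc x y z)
        ; *-identity = (λ x → ≈⇒−∈ (*-identityˡ x)) , (λ x → ≈⇒−∈ (*-identityʳ x))
        ; distrib = (λ x y z → ≈⇒−∈ (distribˡ x y z)) , (λ x y z → ≈⇒−∈ (distribʳ x y z)) } }

  module _ {p} {I K : Pred Carrier p} (K-ideal : IsIdeal K) where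
    open IsIdeal K-ideal

    multIn-*ˡ : ∀ a {s} → MultIn I K s → MultIn I K (a ℕ.* s)
    multIn-*ˡ a {s} ms x ix = resp (sym (·ₙ-assoc a s x)) (·ₙ-∈ K-ideal a (ms x ix))

    multIn-cancel : ∀ {d m n} → d ℕ.+ m ≡ n → MultIn I K m → MultIn I K n → MultIn I K d
    multIn-cancel {d} {m} {n} eq mm mn x ix = resp dx (+∈ (mn x ix) (-∈ (mm x ix)))
      where
        dx : (n ·ₙ x) − (m ·ₙ x) ≈ d ·ₙ x
        dx = begin
          (n ·ₙ x) − (m ·ₙ x)              ≈⟨ +-congʳ (reflexive (≡.cong (_·ₙ x) eq)) ⟨
          ((d ℕ.+ m) ·ₙ x) − (m ·ₙ x)      ≈⟨ +-congʳ (·ₙ-homo-+ d m x) ⟩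
          (d ·ₙ x + m ·ₙ x) − (m ·ₙ x)     ≈⟨ +-G.//-rightDividesʳ (m ·ₙ x) (d ·ₙ x) ⟩
          d ·ₙ x                           ∎

    multIn-gcd : ∀ {s s′} → MultIn I K s → MultIn I K s′ → MultIn I K (gcd s s′)
    multIn-gcd {s} {s′} ms ms′ with Bézout.identity (gcd-GCD s s′)
    ... | Bézout.+- a b eq = multIn-cancel {m = b ℕ.* s′} eq (multIn-*ˡ b {s′} ms′) (multIn-*ˡ a {s} ms)
    ... | Bézout.-+ a b eq = multIn-cancel {m = a ℕ.* s} eq (multIn-*ˡ a {s} ms) (multIn-*ˡ b {s′} ms′)

    characteristic-∣ : ∀ {s s′} → IsCharacteristic I K s → 1 ≤ s′ → MultIn I K s′ → s ∣ s′
    characteristic-∣ {s} {s′} (1≤s , ms , minimal) 1≤s′ ms′ =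
      ≡.subst (_∣ s′) gcd≡s (gcd[m,n]∣n s s′)
      where
        1≤gcd : 1 ≤ gcd s s′
        1≤gcd = ℕP.n≢0⇒n>0 (gcd[m,n]≢0 s s′ (inj₁ (ℕP.n>0⇒n≢0 1≤s)))
        gcd≡s : gcd s s′ ≡ s
        gcd≡s = ℕP.≤-antisym (∣⇒≤ ⦃ ℕ.>-nonZero 1≤s ⦄ (gcd[m,n]∣m s s′))
                             (minimal (gcd s s′) 1≤gcd (multIn-gcd {s} {s′} ms ms′))

module GroupRingArithmetic {c ℓ g ℓg} (S : Ring c ℓ) (G : Group g ℓg) where
  open Ring S using (Carrier; _≈_; _*_; -_; 0#; -‿inverseʳ)
  open Group G using () renaming (refl to ·-refl)
  open RingNotions S using (vprod; _·ₙ_)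
  open IdealTheory S using (ProductOf)
  open GroupRingSemiring S G public
  open SemiringExp semiring using (^-congˡ; ^-assocʳ) renaming (_^_ to _⊗^_) public
  open RawSemiringDefs (Semiring.rawSemiring semiring) using () renaming (_×_ to _⊕×_) public

  pow≡⊗^ : ∀ x n → pow x n ≡ x ⊗^ n
  pow≡⊗^ x zero    = refl
  pow≡⊗^ x (suc n) = ≡.cong (x ⊗_) (pow≡⊗^ x n)

  pow-cong : ∀ n {x x′} → x ∼ x′ → pow x n ∼ pow x′ n
  pow-cong n {x} {x′} p rewrite pow≡⊗^ x n | pow≡⊗^ x′ n = ^-congˡ n p

  pow-* : ∀ x m n → pow x (m ℕ.* n) ∼ pow (pow x m) n
  pow-* x m n rewrite pow≡⊗^ (pow x m) n | pow≡⊗^ x m | pow≡⊗^ x (m ℕ.* n) = ∼-sym (^-assocʳ x m n)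

  pow-one : ∀ n → pow one n ∼ one
  pow-one zero    = ∼-refl
  pow-one (suc n) = ∼-trans (⊗-identityˡ (pow one n)) (pow-one n)

  pow-comm : ∀ x n → pow x n ⊗ x ∼ x ⊗ pow x n
  pow-comm x zero    = ∼-trans (⊗-identityˡ x) (∼-sym (⊗-identityʳ x))
  pow-comm x (suc n) = ∼-trans (⊗-assoc x (pow x n) x) (⊗-congʳ x (pow-comm x n))

  CoeffsIn : ∀ {p} → Pred Carrier p → Pred Elt _
  CoeffsIn P = All (P ∘ proj₂)

  ⊗-coeffs : ∀ {p q t} {P : Pred Carrier p} {Q : Pred Carrier q} {T : Pred Carrier t} →
             (∀ {a b} → P a → Q b → T (a * b)) →
             ∀ {y w} → CoeffsIn P y → CoeffsIn Q w → CoeffsIn T (y ⊗ w)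
  ⊗-coeffs f []          qw = []
  ⊗-coeffs f (pr ∷ py) qw = AllP.++⁺ (AllP.map⁺ (All.map (f pr) qw)) (⊗-coeffs f py qw)

  ⊗-coeffsˡ : ∀ {p} {P : Pred Carrier p} → (∀ b {a} → P a → P (a * b)) →
              ∀ {y} → CoeffsIn P y → ∀ w → CoeffsIn P (y ⊗ w)
  ⊗-coeffsˡ closed []        w = []
  ⊗-coeffsˡ closed (pr ∷ py) w =
    AllP.++⁺ (AllP.map⁺ (All.universal (λ q → closed (proj₂ q) pr) w)) (⊗-coeffsˡ closed py w)

  pow-coeffs : ∀ {p} {P : Pred Carrier p} {y} → CoeffsIn P y → ∀ j → CoeffsIn (ProductOf P j) (pow y j)
  pow-coeffs py zero    = (Vec.[] , VecAll.[] , refl) ∷ []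
  pow-coeffs py (suc j) = ⊗-coeffs (λ { {a} pa (v , pv , refl) → a Vec.∷ v , pa VecAll.∷ pv , refl })
                                   py (pow-coeffs py j)

  neg : Elt → Elt
  neg = map λ { (h , r) → (h , - r) }

  ++-neg : ∀ z → z ++ neg z ∼ []
  ++-neg []             = ∼-refl
  ++-neg ((h , r) ∷ z) =
    ∼-trans (↭⇒∼ (Perm.prep (h , r) (PermP.shift (h , - r) z (neg z))))
      (∼-++ {x = (h , r) ∷ (h , - r) ∷ []} {x′ = []}
        (∼-trans ∼-merge (∼-trans (∼-cong ·-refl (-‿inverseʳ r)) ∼-zero)) (++-neg z))

  infix 4 _∈ᴳ_ _≡1mod_

  _∈ᴳ_ : ∀ {p} → Elt → Pred Carrier p → Set _
  x ∈ᴳ K = ∃[ y ] (CoeffsIn K y × x ∼ y)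

  _≡1mod_ : ∀ {p} → Elt → Pred Carrier p → Set _
  x ≡1mod K = ∃[ y ] (CoeffsIn K y × x ∼ one ++ y)

  ∑-∈ᴳ : ∀ {p} {K : Pred Carrier p} n (f : Fin n → Elt) → (∀ k → f k ∈ᴳ K) → VecF.foldr _++_ [] f ∈ᴳ K
  ∑-∈ᴳ zero    f fK = [] , [] , ∼-refl
  ∑-∈ᴳ (suc n) f fK with fK Fin.zero | ∑-∈ᴳ n (f ∘ Fin.suc) (fK ∘ Fin.suc)
  ... | a , ka , a∼ | b , kb , b∼ = a ++ b , AllP.++⁺ ka kb , ∼-++ a∼ b∼

  ≡1mod-resp : ∀ {p} {K : Pred Carrier p} {x x′} → x ∼ x′ → x ≡1mod K → x′ ≡1mod K
  ≡1mod-resp x∼x′ (y , Ky , x∼1+y) = y , Ky , ∼-trans (∼-sym x∼x′) x∼1+y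

  ≡1mod-zero : ∀ {p} {Z : Pred Carrier p} → (∀ {r} → Z r → r ≈ 0#) → ∀ {x} → x ≡1mod Z → x ∼ one
  ≡1mod-zero Z≈0 (y , Zy , x∼1+y) = ∼-trans x∼1+y (∼-++ˡ one (vanish Zy))
    where
      vanish : ∀ {y} → CoeffsIn _ y → y ∼ []
      vanish []        = ∼-refl
      vanish (zr ∷ zy) = ∼-++ {x′ = []} (∼-trans (∼-cong ·-refl (Z≈0 zr)) ∼-zero) (vanish zy)

  pow-prodFin-≡1mod : ∀ {p m} (N : Fin (suc m) → Pred Carrier p) (s : Fin m → ℕ) →
    (∀ i {x} → x ≡1mod N (inject₁ i) → pow x (s i) ≡1mod N (Fin.suc i)) →
    ∀ {x} → x ≡1mod N Fin.zero → pow x (prodFin s) ≡1mod N (fromℕ m)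
  pow-prodFin-≡1mod {m = zero}  N s step {x} x≡1 = ≡1mod-resp (∼-sym (⊗-identityʳ x)) x≡1
  pow-prodFin-≡1mod {m = suc m} N s step {x} x≡1 =
    ≡1mod-resp (∼-sym (pow-* x (s Fin.zero) (prodFin (s ∘ Fin.suc))))
      (pow-prodFin-≡1mod (N ∘ Fin.suc) (s ∘ Fin.suc) (step ∘ Fin.suc) (step Fin.zero x≡1))

  scale : ℕ → Elt → Elt
  scale n = map λ { (h , r) → (h , n ·ₙ r) }

  ⊕×≈scale : ∀ n z → n ⊕× z ∼ scale n z
  ⊕×≈scale zero    z = ∼-sym (map-∼[] (λ _ → ∼-zero) z)
  ⊕×≈scale (suc n) z = ∼-trans (∼-++ (≡⇒∼ (≡.sym (ListP.map-id z))) (⊕×≈scale n z))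
                                (map-merge (λ _ → ∼-merge) z)

  scale-coeffs : ∀ {p q} {P : Pred Carrier p} {Q : Pred Carrier q} n →
                 (∀ {r} → P r → Q (n ·ₙ r)) → ∀ {z} → CoeffsIn P z → CoeffsIn Q (scale n z)
  scale-coeffs n f pz = AllP.map⁺ (All.map f pz)

module BinomialStep {c ℓ g ℓg p} (S : Ring c ℓ) (G : Group g ℓg)
  {I K : Pred (Ring.Carrier S) p} (I-ideal : RingNotions.IsIdeal S I) (K-ideal : RingNotions.IsIdeal S K)
  {t s : ℕ} (1≤t : 1 ≤ t) (Iᵗ⊆K : RingNotions.IdealPow S I t ⊆ K) (sI⊆K : RingNotions.MultIn S I K s)
  (large : PrimeFactorsAtLeast t s) where

  open Ring S using (Carrier; _*_)
  open RingNotions S using (IsIdeal; MultIn)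
  open IdealTheory S using (·ₙ-∈; productOf-∈; productOf-∈-idealPow; multIn-*ˡ)
  open GroupRingArithmetic S G

  private
    module I = IsIdeal I-ideal
    module K = IsIdeal K-ideal

  binomial-coeffs : ∀ {P : Pred Carrier p} → (∀ b {a} → P a → P (a * b)) →
                    ∀ {y} k → CoeffsIn P (pow y k) → CoeffsIn P ((y ⊗^ k) ⊗ (one ⊗^ (s ∸ k)))
  binomial-coeffs closed {y} k Pyᵏ = ⊗-coeffsˡ closed (≡.subst (CoeffsIn _) (pow≡⊗^ y k) Pyᵏ) _

  term-∈ᴳ : ∀ {y} → CoeffsIn I y → ∀ k → 1 ≤ k → (s C k) ⊕× ((y ⊗^ k) ⊗ (one ⊗^ (s ∸ k))) ∈ᴳ K
  term-∈ᴳ Iy k 1≤k with t ℕP.≤? k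
  ... | yes t≤k =
    _ , scale-coeffs (s C k) (·ₙ-∈ K-ideal (s C k)) (binomial-coeffs K.*ʳ∈ k Kyᵏ) , ⊕×≈scale (s C k) _
    where
      Kyᵏ = All.map (Iᵗ⊆K ∘ productOf-∈-idealPow I-ideal 1≤t t≤k) (pow-coeffs Iy k)
  ... | no t≰k with ∣-binomial large 1≤k (ℕP.≰⇒> t≰k)
  ... | divides q C≡q*s =
    _ , scale-coeffs (s C k) (sCk·I⊆K _) (binomial-coeffs I.*ʳ∈ k Iyᵏ) , ⊕×≈scale (s C k) _
    where
      sCk·I⊆K : MultIn I K (s C k)
      sCk·I⊆K = ≡.subst (MultIn I K) (≡.sym C≡q*s) (multIn-*ˡ K-ideal q sI⊆K)
      Iyᵏ = All.map (productOf-∈ I-ideal 1≤k) (pow-coeffs Iy k)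

  ≡1mod-pow : ∀ {x} → x ≡1mod I → pow x s ≡1mod K
  ≡1mod-pow {x} (y , Iy , x∼1+y)
    with ∑-∈ᴳ s (λ j → Binomial.binomialTerm semiring y one s (Fin.suc j))
               (λ j → term-∈ᴳ Iy (suc (toℕ j)) (s≤s z≤n))
  ... | y′ , Ky′ , terms∼y′ = y′ , Ky′ , (begin
    pow x s                         ≈⟨ pow-cong s (∼-trans x∼1+y (++-comm one y)) ⟩
    pow (y ++ one) s                ≡⟨ pow≡⊗^ (y ++ one) s ⟩
    (y ++ one) ⊗^ s                 ≈⟨ B.theorem y⊗1∼1⊗y s ⟩
    B.binomialExpansion s           ≈⟨ ∼-++ term₀∼one terms∼y′ ⟩
    one ++ y′                       ∎)
    where
      module B = Binomial semiring y one
      open import Relation.Binary.Reasoning.Setoid (Semiring.setoid semiring)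
      y⊗1∼1⊗y : y ⊗ one ∼ one ⊗ y
      y⊗1∼1⊗y = ∼-trans (⊗-identityʳ y) (∼-sym (⊗-identityˡ y))
      term₀∼one : B.binomialTerm s Fin.zero ∼ one
      term₀∼one = ∼-trans (≡⇒∼ (ListP.++-identityʳ _)) (∼-trans (⊗-identityˡ _)
                    (∼-trans (≡⇒∼ (≡.sym (pow≡⊗^ one s))) (pow-one s)))

module Reduction {c ℓ g ℓg p} (R : Ring c ℓ) (G : Group g ℓg)
                 {N : Pred (Ring.Carrier R) p} (N-ideal : RingNotions.IsIdeal R N) where
  open RingNotions R using (module IsIdeal)
  open IdealTheory R using (quotientRing; ≈⇒−∈; +-−-cancel)
  open GroupRingArithmetic R G
  module Q = GroupRingArithmetic (quotientRing N-ideal) G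

  ∼⇒∼mod : ∀ {x y} → x ∼ y → x Q.∼ y
  ∼⇒∼mod ∼-refl        = Q.∼-refl
  ∼⇒∼mod (∼-sym p)     = Q.∼-sym (∼⇒∼mod p)
  ∼⇒∼mod (∼-trans p q) = Q.∼-trans (∼⇒∼mod p) (∼⇒∼mod q)
  ∼⇒∼mod (∼-++ p q)    = Q.∼-++ (∼⇒∼mod p) (∼⇒∼mod q)
  ∼⇒∼mod ∼-swap        = Q.∼-swap
  ∼⇒∼mod (∼-cong h r)  = Q.∼-cong h (≈⇒−∈ N-ideal r)
  ∼⇒∼mod ∼-merge       = Q.∼-merge
  ∼⇒∼mod ∼-zero        = Q.∼-zero

  reduceUnit : Units → Q.Units
  reduceUnit (x , x⁻¹ , xx⁻¹∼1 , x⁻¹x∼1) = x , x⁻¹ , ∼⇒∼mod xx⁻¹∼1 , ∼⇒∼mod x⁻¹x∼1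

  Q-pow≡pow : ∀ x n → Q.pow x n ≡ pow x n
  Q-pow≡pow x zero    = refl
  Q-pow≡pow x (suc n) = ≡.cong (x ⊗_) (Q-pow≡pow x n)

  infix 4 _≋_
  _≋_ : Elt → Elt → Set _
  x ≋ y = ∃[ z ] ∃[ w ] (CoeffsIn N z × CoeffsIn N w × x ++ z ∼ y ++ w)

  ∼mod⇒≋ : ∀ {x y} → x Q.∼ y → x ≋ y
  ∼mod⇒≋ Q.∼-refl = [] , [] , [] , [] , ∼-refl
  ∼mod⇒≋ (Q.∼-sym p) with ∼mod⇒≋ p
  ... | z , w , Nz , Nw , eq = w , z , Nw , Nz , ∼-sym eq
  ∼mod⇒≋ (Q.∼-trans {x} {y} {u} p q) with ∼mod⇒≋ p | ∼mod⇒≋ q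
  ... | z₁ , w₁ , Nz₁ , Nw₁ , eq₁ | z₂ , w₂ , Nz₂ , Nw₂ , eq₂ =
    z₁ ++ z₂ , w₂ ++ w₁ , AllP.++⁺ Nz₁ Nz₂ , AllP.++⁺ Nw₂ Nw₁ ,
    ∼-trans (≡⇒∼ (≡.sym (ListP.++-assoc x z₁ z₂)))
      (∼-trans (∼-++ʳ z₂ eq₁) (∼-trans (xy∙z≈xz∙y y w₁ z₂)
        (∼-trans (∼-++ʳ w₁ eq₂) (≡⇒∼ (ListP.++-assoc u w₂ w₁)))))
  ∼mod⇒≋ (Q.∼-++ {x} {x′} {y} {y′} p q) with ∼mod⇒≋ p | ∼mod⇒≋ q
  ... | z₁ , w₁ , Nz₁ , Nw₁ , eq₁ | z₂ , w₂ , Nz₂ , Nw₂ , eq₂ =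
    z₁ ++ z₂ , w₁ ++ w₂ , AllP.++⁺ Nz₁ Nz₂ , AllP.++⁺ Nw₁ Nw₂ ,
    ∼-trans (interchange x y z₁ z₂) (∼-trans (∼-++ eq₁ eq₂) (interchange x′ w₁ y′ w₂))
  ∼mod⇒≋ Q.∼-swap  = [] , [] , [] , [] , ∼-++ʳ [] ∼-swap
  ∼mod⇒≋ Q.∼-merge = [] , [] , [] , [] , ∼-++ʳ [] ∼-merge
  ∼mod⇒≋ Q.∼-zero  = [] , [] , [] , [] , ∼-++ʳ [] ∼-zero
  ∼mod⇒≋ (Q.∼-cong {h} {h′} {r} {r′} h≈h′ r−r′∈N) =
    [] , (h′ , r − r′) ∷ [] , [] , r−r′∈N ∷ [] ,
    ∼-sym (∼-trans ∼-merge (∼-cong (Group.sym G h≈h′) (+-−-cancel r r′)))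
    where open RingNotions R using (_−_)

  neg-coeffs : ∀ {z} → CoeffsIn N z → CoeffsIn N (neg z)
  neg-coeffs Nz = AllP.map⁺ (All.map (IsIdeal.-∈ N-ideal) Nz)

  ∼mod-one⇒≡1mod : ∀ {x} → x Q.∼ Q.one → x ≡1mod N
  ∼mod-one⇒≡1mod {x} x∼1 with ∼mod⇒≋ x∼1
  ... | z , w , Nz , Nw , x+z∼1+w = w ++ neg z , AllP.++⁺ Nw (neg-coeffs Nz) , (begin
    x                       ≡⟨ ListP.++-identityʳ x ⟨
    x ++ []                 ≈⟨ ∼-++ˡ x (++-neg z) ⟨
    x ++ (z ++ neg z)       ≡⟨ ListP.++-assoc x z (neg z) ⟨
    (x ++ z) ++ neg z       ≈⟨ ∼-++ʳ (neg z) x+z∼1+w ⟩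
    (one ++ w) ++ neg z     ≡⟨ ListP.++-assoc one w (neg z) ⟩
    one ++ (w ++ neg z)     ∎)
    where open import Relation.Binary.Reasoning.Setoid (Semiring.setoid semiring)

  pow-≡1mod : ∀ w → (∀ (x : Q.Units) → Q.pow (proj₁ x) w Q.∼ Q.one) →
              ∀ (x : Units) → pow (proj₁ x) w ≡1mod N
  pow-≡1mod w reduced-order x =
    ∼mod-one⇒≡1mod (≡.subst (Q._∼ Q.one) (Q-pow≡pow (proj₁ x) w) (reduced-order (reduceUnit x)))

module GroupRingUnits {c ℓ g ℓg} (S : Ring c ℓ) (G : Group g ℓg) where
  open GroupRingArithmetic S G
  open MonoidOrbits (Semiring.*-monoid semiring) public
    using (_^ᴹ_; LeftCancellable; RightCancellable; ^ᴹ-size≈ε)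
  open import Relation.Binary.Reasoning.Setoid (Semiring.setoid semiring)

  isUnit⇒rightCancellable : ∀ {x} → IsUnit x → RightCancellable x
  isUnit⇒rightCancellable {x} (x′ , xx′∼1 , _) {y} {z} yx∼zx = begin
    y                  ≈⟨ ⊗-identityʳ y ⟨
    y ⊗ one            ≈⟨ ⊗-congʳ y xx′∼1 ⟨
    y ⊗ (x ⊗ x′)       ≈⟨ ⊗-assoc y x x′ ⟨
    (y ⊗ x) ⊗ x′       ≈⟨ ⊗-congˡ x′ yx∼zx ⟩
    (z ⊗ x) ⊗ x′       ≈⟨ ⊗-assoc z x x′ ⟩
    z ⊗ (x ⊗ x′)       ≈⟨ ⊗-congʳ z xx′∼1 ⟩
    z ⊗ one            ≈⟨ ⊗-identityʳ z ⟩
    z                  ∎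

  isUnit⇒leftCancellable : ∀ {x} → IsUnit x → LeftCancellable x
  isUnit⇒leftCancellable {x} (x′ , _ , x′x∼1) {y} {z} xy∼xz = begin
    y                  ≈⟨ ⊗-identityˡ y ⟨
    one ⊗ y            ≈⟨ ⊗-congˡ y x′x∼1 ⟨
    (x′ ⊗ x) ⊗ y       ≈⟨ ⊗-assoc x′ x y ⟩
    x′ ⊗ (x ⊗ y)       ≈⟨ ⊗-congʳ x′ xy∼xz ⟩
    x′ ⊗ (x ⊗ z)       ≈⟨ ⊗-assoc x′ x z ⟨
    (x′ ⊗ x) ⊗ z       ≈⟨ ⊗-congˡ z x′x∼1 ⟩
    one ⊗ z            ≈⟨ ⊗-identityˡ z ⟩
    z                  ∎

  _·ᵤ_ : Units → Units → Units
  (x , x′ , xx′∼1 , x′x∼1) ·ᵤ (y , y′ , yy′∼1 , y′y∼1) =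
    x ⊗ y , y′ ⊗ x′ , cancel x y y′ x′ yy′∼1 xx′∼1 , cancel y′ x′ x y x′x∼1 y′y∼1
    where
      cancel : ∀ a b b′ a′ → b ⊗ b′ ∼ one → a ⊗ a′ ∼ one → (a ⊗ b) ⊗ (b′ ⊗ a′) ∼ one
      cancel a b b′ a′ bb′∼1 aa′∼1 = begin
        (a ⊗ b) ⊗ (b′ ⊗ a′)    ≈⟨ ⊗-assoc a b (b′ ⊗ a′) ⟩
        a ⊗ (b ⊗ (b′ ⊗ a′))    ≈⟨ ⊗-congʳ a (⊗-assoc b b′ a′) ⟨
        a ⊗ ((b ⊗ b′) ⊗ a′)    ≈⟨ ⊗-congʳ a (⊗-congˡ a′ bb′∼1) ⟩
        a ⊗ (one ⊗ a′)         ≈⟨ ⊗-congʳ a (⊗-identityˡ a′) ⟩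
        a ⊗ a′                 ≈⟨ aa′∼1 ⟩
        one                    ∎

  pow-card≈one : ∀ {n} → HasCard Units _≈U_ n → ∀ (u : Units) → pow (proj₁ u) n ∼ one
  pow-card≈one {n} (enum , enum-injective , enum-surjective) u@(x , x-unit) =
    ≡.subst (_∼ one) (≡.sym (pow≡⊗^ x n))
      (^ᴹ-size≈ε (proj₁ ∘ enum) enum-injective (isUnit⇒rightCancellable ∘ proj₂ ∘ enum)
                 (isUnit⇒leftCancellable x-unit) (λ i → enum-surjective (u ·ᵤ enum i)))

  pow≈one⇒isUnit : ∀ {x} n → pow x (suc n) ∼ one → IsUnit x
  pow≈one⇒isUnit {x} n xⁿ⁺¹∼1 = pow x n , xⁿ⁺¹∼1 , ∼-trans (pow-comm x n) xⁿ⁺¹∼1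

module CNCPowers {c ℓ g ℓg p} (R : Ring c ℓ) (G : Group g ℓg)
  {m : ℕ} {N : Fin (suc m) → Pred (Ring.Carrier R) p} (cnc : RingNotions.CNC R m N)
  {s : Fin m → ℕ} (chars : ∀ i → RingNotions.IsCharacteristic R (N (inject₁ i)) (N (Fin.suc i)) (s i)) where
  open RingNotions.CNC cnc
  open IdealTheory R using (characteristic-∣)
  open GroupRingArithmetic R G
  open GroupRingUnits R G using (pow≈one⇒isUnit)
  module Red = Reduction R G (ideals Fin.zero)

  ≡1mod-pow-characteristic : ∀ i {x} → x ≡1mod N (inject₁ i) → pow x (s i) ≡1mod N (Fin.suc i)
  ≡1mod-pow-characteristic i with nilchar i
  ... | t , 2≤t , Nᵗ⊆N′ , s′ , 1≤s′ , s′N⊆N′ , large′ =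
    BinomialStep.≡1mod-pow R G (ideals (inject₁ i)) (ideals (Fin.suc i)) (ℕP.<⇒≤ 2≤t) Nᵗ⊆N′
                           (proj₁ (proj₂ (chars i))) large
    where
      -- The bound on prime factors is assumed for some multiplier s′, and the characteristic divides it.
      large : PrimeFactorsAtLeast t (s i)
      large q prime-q q∣sᵢ = large′ q prime-q
        (∣-trans q∣sᵢ (characteristic-∣ (ideals (Fin.suc i)) (chars i) 1≤s′ s′N⊆N′))

  pow-prodFin≈one : ∀ {x} → x ≡1mod N Fin.zero → pow x (prodFin s) ∼ one
  pow-prodFin≈one x≡1 = ≡1mod-zero (bottom⇒ _) (pow-prodFin-≡1mod N s ≡1mod-pow-characteristic x≡1)

  pow-*-prodFin≈one : ∀ w → (∀ (x : Red.Q.Units) → Red.Q.pow (proj₁ x) w Red.Q.∼ Red.Q.one) →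
                      ∀ (x : Units) → pow (proj₁ x) (w ℕ.* prodFin s) ∼ one
  pow-*-prodFin≈one w reduced-order x =
    ∼-trans (pow-* (proj₁ x) w (prodFin s)) (pow-prodFin≈one (Red.pow-≡1mod w reduced-order x))

  ≡1mod⇒isUnit : ∀ {x} → x ≡1mod N Fin.zero → IsUnit x
  ≡1mod⇒isUnit {x} x≡1 = pow≈one⇒isUnit (prodFin s ∸ 1)
    (≡.subst (λ n → pow x n ∼ one) (≡.sym (ℕP.m+[n∸m]≡n (prodFin-positive s (proj₁ ∘ chars))))
             (pow-prodFin≈one x≡1))

module Coefficients {c ℓ g ℓg} (S : Ring c ℓ) (G : Group g ℓg) {d : ℕ}
                    (G-finite : HasCard (Group.Carrier G) (Group._≈_ G) d) where
  open Ring S renaming (refl to ≈-refl)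
  open Group G using () renaming (Carrier to Gc; _≈_ to _≈G_)
  open GroupRingArithmetic S G

  element : Fin d → Gc
  element = proj₁ G-finite

  index : Gc → Fin d
  index h = proj₁ (proj₂ (proj₂ G-finite) h)

  element-index : ∀ h → element (index h) ≈G h
  element-index h = proj₂ (proj₂ (proj₂ G-finite) h)

  index-cong : ∀ {h h′} → h ≈G h′ → index h ≡ index h′
  index-cong {h} {h′} h≈h′ = proj₁ (proj₂ G-finite) (index h) (index h′)
    (Group.trans G (element-index h) (Group.trans G h≈h′ (Group.sym G (element-index h′))))

  index-element : ∀ i → index (element i) ≡ i
  index-element i = proj₁ (proj₂ G-finite) _ i (element-index (element i))

  addAt : ∀ {m} → Fin m → Carrier → (Fin m → Carrier) → Fin m → Carrier
  addAt k r a i = if does (k FinP.≟ i) then r + a i else a i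

  coeff : Fin d → Elt → Carrier
  coeff i []             = 0#
  coeff i ((h , r) ∷ w) = addAt (index h) r (λ j → coeff j w) i

  coeff-++ : ∀ i x y → coeff i (x ++ y) ≈ coeff i x + coeff i y
  coeff-++ i []             y = sym (+-identityˡ _)
  coeff-++ i ((h , r) ∷ x) y with index h FinP.≟ i
  ... | yes _ = trans (+-congˡ (coeff-++ i x y)) (sym (+-assoc r (coeff i x) (coeff i y)))
  ... | no  _ = coeff-++ i x y

  coeff-cong : ∀ i {w w′} → w ∼ w′ → coeff i w ≈ coeff i w′
  coeff-cong i ∼-refl        = ≈-refl
  coeff-cong i (∼-sym p)     = sym (coeff-cong i p)
  coeff-cong i (∼-trans p q) = trans (coeff-cong i p) (coeff-cong i q)
  coeff-cong i (∼-++ {x} {x′} {y} {y′} p q) =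
    trans (coeff-++ i x y) (trans (+-cong (coeff-cong i p) (coeff-cong i q)) (sym (coeff-++ i x′ y′)))
  coeff-cong i (∼-swap {h , r} {k , s}) with index h FinP.≟ i | index k FinP.≟ i
  ... | yes _ | yes _ = trans (sym (+-assoc r s 0#)) (trans (+-congʳ (+-comm r s)) (+-assoc s r 0#))
  ... | yes _ | no  _ = ≈-refl
  ... | no  _ | yes _ = ≈-refl
  ... | no  _ | no  _ = ≈-refl
  coeff-cong i (∼-cong {h} {h′} h≈h′ r≈r′) rewrite index-cong h≈h′ with index h′ FinP.≟ i
  ... | yes _ = +-cong r≈r′ ≈-refl
  ... | no  _ = ≈-refl
  coeff-cong i (∼-merge {h} {r} {r′}) with index h FinP.≟ i
  ... | yes _ = sym (+-assoc r r′ 0#)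
  ... | no  _ = ≈-refl
  coeff-cong i (∼-zero {h}) with index h FinP.≟ i
  ... | yes _ = +-identityˡ 0#
  ... | no  _ = ≈-refl

  coeff-∈ : ∀ {p} {N : Pred Carrier p} → RingNotions.IsIdeal S N → ∀ i {w} → CoeffsIn N w → N (coeff i w)
  coeff-∈ N-ideal i []                       = RingNotions.IsIdeal.zero∈ N-ideal
  coeff-∈ N-ideal i {(h , _) ∷ _} (Nr ∷ Nw) with index h FinP.≟ i
  ... | yes _ = RingNotions.IsIdeal.+∈ N-ideal Nr (coeff-∈ N-ideal i Nw)
  ... | no  _ = coeff-∈ N-ideal i Nw

  tabulate-cong : ∀ {m} (φ : Fin m → Gc) {a a′ : Fin m → Carrier} → (∀ i → a i ≈ a′ i) →
                  List.tabulate (λ i → φ i , a i) ∼ List.tabulate (λ i → φ i , a′ i)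
  tabulate-cong {zero}  φ a≈a′ = ∼-refl
  tabulate-cong {suc m} φ a≈a′ =
    ∼-++ {x = (φ Fin.zero , _) ∷ []} (∼-cong (Group.refl G) (a≈a′ Fin.zero))
         (tabulate-cong (φ ∘ Fin.suc) (a≈a′ ∘ Fin.suc))

  tabulate-zero : ∀ {m} (φ : Fin m → Gc) → List.tabulate (λ i → φ i , 0#) ∼ []
  tabulate-zero {zero}  φ = ∼-refl
  tabulate-zero {suc m} φ = ∼-++ {x = (φ Fin.zero , 0#) ∷ []} {x′ = []} ∼-zero (tabulate-zero (φ ∘ Fin.suc))

  tabulate-insert : ∀ {m} (φ : Fin m → Gc) k r (a : Fin m → Carrier) →
    (φ k , r) ∷ List.tabulate (λ i → φ i , a i) ∼ List.tabulate (λ i → φ i , addAt k r a i)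
  tabulate-insert {suc m} φ Fin.zero    r a =
    ∼-++ {x = (φ Fin.zero , r) ∷ (φ Fin.zero , a Fin.zero) ∷ []} ∼-merge ∼-refl
  tabulate-insert {suc m} φ (Fin.suc k) r a =
    ∼-trans (∼-++ {x = (φ (Fin.suc k) , r) ∷ (φ Fin.zero , a Fin.zero) ∷ []} ∼-swap ∼-refl)
            (∼-++ {x = (φ Fin.zero , a Fin.zero) ∷ []} ∼-refl
                  (tabulate-insert (φ ∘ Fin.suc) k r (a ∘ Fin.suc)))

  nf : (Fin d → Carrier) → Elt
  nf a = List.tabulate λ i → element i , a i

  ∼nf : ∀ w → w ∼ nf (λ i → coeff i w)
  ∼nf []             = ∼-sym (tabulate-zero element)
  ∼nf ((h , r) ∷ w) =
    ∼-trans (∼-++ {x = (h , r) ∷ []} (∼-cong (Group.sym G (element-index h)) ≈-refl) (∼nf w))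
            (tabulate-insert element (index h) r (λ i → coeff i w))

  coeff-tabulate-∉ : ∀ {m} (ι : Fin m → Fin d) (a : Fin m → Carrier) i → (∀ j → ι j ≢ i) →
                     coeff i (List.tabulate λ k → element (ι k) , a k) ≈ 0#
  coeff-tabulate-∉ {zero}  ι a i ι≢i = ≈-refl
  coeff-tabulate-∉ {suc m} ι a i ι≢i rewrite index-element (ι Fin.zero) with ι Fin.zero FinP.≟ i
  ... | yes ι₀≡i = ⊥-elim (ι≢i Fin.zero ι₀≡i)
  ... | no  _    = coeff-tabulate-∉ (ι ∘ Fin.suc) (a ∘ Fin.suc) i (ι≢i ∘ Fin.suc)

  -- Generalised to an injective relabelling ι so that the induction on the list goes through.
  coeff-tabulate : ∀ {m} (ι : Fin m → Fin d) (a : Fin m → Carrier) i → (∀ {j k} → ι j ≡ ι k → j ≡ k) →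
                   ∀ j → ι j ≡ i → coeff i (List.tabulate λ k → element (ι k) , a k) ≈ a j
  coeff-tabulate {suc m} ι a i ι-injective Fin.zero ι₀≡i rewrite index-element (ι Fin.zero)
    with ι Fin.zero FinP.≟ i
  ... | yes _    = trans (+-congˡ (coeff-tabulate-∉ (ι ∘ Fin.suc) (a ∘ Fin.suc) i
                           (λ j ιⱼ₊₁≡i → FinP.0≢1+n (ι-injective (≡.trans ι₀≡i (≡.sym ιⱼ₊₁≡i))))))
                         (+-identityʳ _)
  ... | no ι₀≢i  = ⊥-elim (ι₀≢i ι₀≡i)
  coeff-tabulate {suc m} ι a i ι-injective (Fin.suc j) ιⱼ₊₁≡i rewrite index-element (ι Fin.zero)
    with ι Fin.zero FinP.≟ i
  ... | yes ι₀≡i = ⊥-elim (FinP.0≢1+n (ι-injective (≡.trans ι₀≡i (≡.sym ιⱼ₊₁≡i))))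
  ... | no  _    = coeff-tabulate (ι ∘ Fin.suc) (a ∘ Fin.suc) i (FinP.suc-injective ∘ ι-injective) j ιⱼ₊₁≡i

  coeff-nf : ∀ a i → coeff i (nf a) ≈ a i
  coeff-nf a i = coeff-tabulate id a i id i refl

funToFin-cong : ∀ {m n} {f f′ : Fin m → Fin n} → (∀ i → f i ≡ f′ i) → Fin.funToFin f ≡ Fin.funToFin f′
funToFin-cong {zero}  _     = refl
funToFin-cong {suc m} f≗f′ = ≡.cong₂ Fin.combine (f≗f′ Fin.zero) (funToFin-cong (f≗f′ ∘ Fin.suc))

module FiniteCongruenceSubgroup {c ℓ g ℓg p} (R : Ring c ℓ) (G : Group g ℓg)
  {N : Pred (Ring.Carrier R) p} (N-ideal : RingNotions.IsIdeal R N) {b d : ℕ}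
  (N-finite : HasCard (Σ (Ring.Carrier R) N) (λ x y → Ring._≈_ R (proj₁ x) (proj₁ y)) b)
  (G-finite : HasCard (Group.Carrier G) (Group._≈_ G) d)
  (≡1mod⇒isUnit : ∀ {x} → GroupRingArithmetic._≡1mod_ R G x N → RG.IsUnit R G x) where
  open Ring R using (Carrier; _≈_; trans; sym; reflexive)
  open GroupRingArithmetic R G
  open GroupRingUnits R G
  open Coefficients R G G-finite
  private module +-G = GroupProperties (Ring.+-group R)

  value : Fin b → Carrier
  value k = proj₁ (proj₁ N-finite k)

  code : ∀ r → N r → Fin b
  code r Nr = proj₁ (proj₂ (proj₂ N-finite) (r , Nr))

  value-code : ∀ r Nr → value (code r Nr) ≈ r
  value-code r Nr = proj₂ (proj₂ (proj₂ N-finite) (r , Nr))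

  coefficients : Fin (b ^ d) → Fin d → Fin b
  coefficients = Fin.finToFun

  fromCoefficients : (Fin d → Fin b) → Fin (b ^ d)
  fromCoefficients = Fin.funToFin

  -- The b ^ d elements of 1 + NG, indexed through their coefficient functions Fin d → Fin b.
  embed : Fin (b ^ d) → Elt
  embed k = one ++ nf (value ∘ coefficients k)

  embed-injective : ∀ k k′ → embed k ∼ embed k′ → k ≡ k′
  embed-injective k k′ eq = begin
    k                                   ≡⟨ FinP.funToFin-finToFin {d} {b} k ⟨
    fromCoefficients (coefficients k)       ≡⟨ funToFin-cong same-coefficient ⟩
    fromCoefficients (coefficients k′)      ≡⟨ FinP.funToFin-finToFin {d} {b} k′ ⟩
    k′                                  ∎
    where
      open ≡.≡-Reasoning
      same-coefficient : ∀ i → coefficients k i ≡ coefficients k′ i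
      same-coefficient i = proj₁ (proj₂ N-finite) _ _ (trans (sym (coeff-nf _ i)) (trans
        (+-G.∙-cancelˡ (coeff i one) _ _
          (trans (sym (coeff-++ i one (nf _))) (trans (coeff-cong i eq) (coeff-++ i one (nf _)))))
        (coeff-nf _ i)))

  embed-≡1mod : ∀ k → embed k ≡1mod N
  embed-≡1mod k = _ , AllP.tabulate⁺ (λ i → proj₂ (proj₁ N-finite (coefficients k i))) , ∼-refl

  decode : ∀ w → CoeffsIn N w → Fin (b ^ d)
  decode w Nw = fromCoefficients λ i → code (coeff i w) (coeff-∈ N-ideal i Nw)

  embed-decode : ∀ w Nw → embed (decode w Nw) ∼ one ++ w
  embed-decode w Nw = ∼-++ˡ one (∼-trans
    (tabulate-cong element λ i → trans (reflexive (≡.cong value (FinP.finToFun-funToFin _ i))) (value-code _ _))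
    (∼-sym (∼nf w)))

  pow-size≈one : ∀ {x} → x ≡1mod N → pow x (b ^ d) ∼ one
  pow-size≈one {x} x≡1@(y , Ny , x∼1+y) = ≡.subst (_∼ one) (≡.sym (pow≡⊗^ x (b ^ d)))
    (^ᴹ-size≈ε embed embed-injective (λ k → isUnit⇒rightCancellable (≡1mod⇒isUnit (embed-≡1mod k)))
               (isUnit⇒leftCancellable (≡1mod⇒isUnit x≡1)) translate)
    where
      open import Relation.Binary.Reasoning.Setoid (Semiring.setoid semiring)
      translate : ∀ k → ∃[ k′ ] (embed k′ ∼ x ⊗ embed k)
      translate k = decode w Nw , (begin
        embed (decode w Nw)                     ≈⟨ embed-decode w Nw ⟩
        one ++ (z ++ y ⊗ embed k)               ≡⟨ ListP.++-assoc one z (y ⊗ embed k) ⟨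
        embed k ++ y ⊗ embed k                  ≈⟨ ∼-++ʳ (y ⊗ embed k) (⊗-identityˡ (embed k)) ⟨
        one ⊗ embed k ++ y ⊗ embed k            ≡⟨ ⊗-distribʳ-≡ one y (embed k) ⟨
        (one ++ y) ⊗ embed k                    ≈⟨ ⊗-congˡ (embed k) x∼1+y ⟨
        x ⊗ embed k                             ∎)
        where
          z = nf (value ∘ coefficients k)
          w = z ++ y ⊗ embed k
          Nw = AllP.++⁺ (proj₁ (proj₂ (embed-≡1mod k)))
                        (⊗-coeffsˡ (RingNotions.IsIdeal.*ʳ∈ N-ideal) Ny (embed k))

open import Data.Nat using (_*_)

proposition4p3 : ∀ {c ℓ g ℓg p} (R : Ring c ℓ) (G : Group g ℓg)
    (m : ℕ) (N : Fin (suc m) → Pred (Ring.Carrier R) p)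
    → RingNotions.CNC R m N
    → (s : Fin m → ℕ)
    → (∀ i → RingNotions.IsCharacteristic R (N (inject₁ i)) (N (Fin.suc i)) (s i))
    → ((w : ℕ)
        → (∀ (x : QG.Units R (N zero) G) → QG._∼_ R (N zero) G (QG.pow R (N zero) G (proj₁ x) w) (QG.one R (N zero) G))
        → ∀ (x : RG.Units R G) → RG._∼_ R G (RG.pow R G (proj₁ x) (w * prodFin s)) (RG.one R G))
      × ((n : ℕ)
        → HasCard (QG.Units R (N zero) G) (QG._≈U_ R (N zero) G) n
        → ∀ (x : RG.Units R G) → RG._∼_ R G (RG.pow R G (proj₁ x) (n * prodFin s)) (RG.one R G))
      × ((n : ℕ)
        → HasCard (RG.Units R G) (RG._≈U_ R G) n
        → (a b d : ℕ)
        → HasCard (QG.Units R (N zero) G) (QG._≈U_ R (N zero) G) a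
        → HasCard (Σ (Ring.Carrier R) (N zero)) (λ x y → Ring._≈_ R (proj₁ x) (proj₁ y)) b
        → HasCard (Group.Carrier G) (Group._≈_ G) d
        → ∀ (x : RG.Units R G) → RG._∼_ R G (RG.pow R G (proj₁ x) (a * b ^ d)) (RG.one R G))
proposition4p3 R G m N cnc s chars =
    pow-*-prodFin≈one
  , (λ n card → pow-*-prodFin≈one n (Q.pow-card≈one card))
  , λ _ _ a b d card N-finite G-finite x →
      ∼-trans (pow-* (proj₁ x) a (b ^ d))
        (FiniteCongruenceSubgroup.pow-size≈one R G (ideals zero) N-finite G-finite ≡1mod⇒isUnit
          (Red.pow-≡1mod a (Q.pow-card≈one card) x))
  where
    open RingNotions.CNC cnc using (ideals)
    open GroupRingArithmetic R G using (∼-trans; pow-*)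
    open CNCPowers R G cnc chars using (pow-*-prodFin≈one; ≡1mod⇒isUnit; module Red)
    module Q = GroupRingUnits (IdealTheory.quotientRing R (ideals zero)) G
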